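{- Let $k\ge 3$ and let $P_k$ be the path with $k$ edges. Then $\sup_n \mathrm{schex}_3(n,\mathcal{B}(P_k))=k$ and $\sup_n \mathrm{wchex}_3(n,\mathcal{B}(P_k))=\lceil k/2\rceil$.
   Context: For a graph $F$, a hypergraph $\mathcal{H}$ is a Berge-$F$ if there is a bijection $f:E(F)\to E(\mathcal{H})$ with $e\subseteq f(e)$ for every $e\in E(F)$; $\mathcal{B}(F)$ is the family of Berge-$F$ hypergraphs, and $\mathcal{B}(F)$-free means containing no subhypergraph in $\mathcal{B}(F)$. $\mathrm{schex}_3(n,\mathcal{B}(F))$ (resp. $\mathrm{wchex}_3(n,\mathcal{B}(F))$) is the supremum of the strong (resp. weak) chromatic number over $\mathcal{B}(F)$-free $3$-uniform hypergraphs on $n$ vertices. The strong chromatic number is the minimum number of colors in a vertex coloring with every hyperedge rainbow; the weak chromatic number is the minimum number of colors in a vertex coloring with no monochromatic hyperedge. -}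

module Defs where

open import Level using (0ℓ)
open import Data.Nat using (ℕ; suc; _≤_)
open import Data.Fin using (Fin; zero; suc; inject₁)
open import Data.Fin.Subset using (Subset; _∈_; ∣_∣)
open import Data.Product using (Σ; _×_; ∃)
open import Relation.Nullary using (¬_)
open import Relation.Binary.PropositionalEquality using (_≡_; _≢_)
open import Function.Definitions using (Injective)

record Hypergraph3 (n : ℕ) : Set₁ where
  field
    Edge    : Subset n → Set
    uniform : ∀ e → Edge e → ∣ e ∣ ≡ 3
open Hypergraph3 public

-- The path P_k with k edges has vertices 0,…,k and edges {i, i+1} for i < k.
ContainsBergePath : ∀ {n} → Hypergraph3 n → ℕ → Set
ContainsBergePath {n} H k =
  Σ (Fin (suc k) → Fin n) λ v →
  Σ (Fin k → Subset n) λ e →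
    Injective _≡_ _≡_ v ×
    Injective _≡_ _≡_ e ×
    (∀ i → Edge H (e i)) ×
    (∀ i → (v (inject₁ i) ∈ e i) × (v (suc i) ∈ e i))

BergePathFree : ∀ {n} → Hypergraph3 n → ℕ → Set
BergePathFree H k = ¬ ContainsBergePath H k

StrongColouring : ∀ {n} → Hypergraph3 n → (m : ℕ) → (Fin n → Fin m) → Set
StrongColouring {n} H m c =
  ∀ e → Edge H e → ∀ (x y : Fin n) → x ∈ e → y ∈ e → x ≢ y → c x ≢ c y

WeakColouring : ∀ {n} → Hypergraph3 n → (m : ℕ) → (Fin n → Fin m) → Set
WeakColouring {n} H m c =
  ∀ e → Edge H e → ¬ (Σ (Fin m) λ j → ∀ (x : Fin n) → x ∈ e → c x ≡ j)

StrongColourable : ∀ {n} → Hypergraph3 n → ℕ → Set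
StrongColourable {n} H m = Σ (Fin n → Fin m) (StrongColouring H m)

WeakColourable : ∀ {n} → Hypergraph3 n → ℕ → Set
WeakColourable {n} H m = Σ (Fin n → Fin m) (WeakColouring H m)

IsStrongChromaticNumber : ∀ {n} → Hypergraph3 n → ℕ → Set
IsStrongChromaticNumber H χ =
  StrongColourable H χ × (∀ m → StrongColourable H m → χ ≤ m)

IsWeakChromaticNumber : ∀ {n} → Hypergraph3 n → ℕ → Set
IsWeakChromaticNumber H χ =
  WeakColourable H χ × (∀ m → WeakColourable H m → χ ≤ m)

-- sup_n schex_3(n, B(P_k)) = s  (values are natural numbers, so the supremum
-- equals s iff every value is ≤ s and s is attained)
SupSchexPath : ℕ → ℕ → Set₁
SupSchexPath k s =
  (∀ n (H : Hypergraph3 n) → BergePathFree H k →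
     ∀ χ → IsStrongChromaticNumber H χ → χ ≤ s) ×
  (Σ ℕ λ n → Σ (Hypergraph3 n) λ H →
     BergePathFree H k × IsStrongChromaticNumber H s)

SupWchexPath : ℕ → ℕ → Set₁
SupWchexPath k s =
  (∀ n (H : Hypergraph3 n) → BergePathFree H k →
     ∀ χ → IsWeakChromaticNumber H χ → χ ≤ s) ×
  (Σ ℕ λ n → Σ (Hypergraph3 n) λ H →
     BergePathFree H k × IsWeakChromaticNumber H s)

{-# OPTIONS --safe #-}
-- Strong colourings are proper colourings of the 2-shadow. If every vertex of a vertex set S had
-- at least k shadow-neighbours inside S, every Berge path inside S with L < k edges could be
-- extended at its end v₀: a neighbour w of v₀ off the path yields a new edge unless w lies in the
-- first edge, i.e. e₀ = {v₀, v₁, w}. In that case (for L = 1, k ≥ 3 supplies a third neighbour)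
-- a rotation through the other end, applied to the path and to the path started at w instead of
-- v₀, either extends it or puts both v₀ and w into the last edge, which would then contain four
-- vertices. Hence a Berge-P_k-free hypergraph is (k−1)-degenerate in the shadow and greedily
-- strongly k-colourable; merging the colours 2i and 2i+1 turns this into a weak ⌈k/2⌉-colouring,
-- as hyperedges are rainbow. The complete 3-graph on k vertices is Berge-P_k-free and needs k
-- colours in a strong and ⌈k/2⌉ in a weak colouring, since each weak colour class has at most two
-- vertices.
-- Hyperedges are an arbitrary predicate, so a low-degree vertex is only found up to double
-- negation; this suffices since the bounds are decidable inequalities.
module Submission where

open import Defs
open import Data.Nat using (ℕ; _≤_; ⌈_/2⌉)
open import Data.Product using (_×_)

open import Data.Nat using (zero; suc; _+_; _*_; _<_; _≤?_; z≤n; s≤s; s≤s⁻¹)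
open import Data.Nat.Properties
  using ( module ≤-Reasoning; 0≢1+n; suc-injective; ≤-trans; ≤-antisym; ≤-refl; <-≤-trans; <⇒≱
        ; m≤n⇒m≤1+n; +-suc; +-monoʳ-≤; +-identityʳ; *-comm; n≮n; n≡⌈n+n/2⌉; ⌈n/2⌉-mono)
open import Data.Fin using (Fin; zero; suc; inject₁; fromℕ; opposite; combine)
  renaming (_<_ to _<ᶠ_)
open import Data.Fin.Properties
  using ( any?; all?; _≟_; injective⇒≤; combine-injective; <-cmp; <⇒≢; <-trans
        ; opposite-involutive; fromℕ≢inject₁)
  renaming (suc-injective to fsuc-injective; _<?_ to _<ᶠ?_)
open import Data.Fin.Subset
  using (Subset; inside; outside; _∈_; _∉_; _─_; _-_; _∪_; ⁅_⁆; ∣_∣; ⊤)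
open import Data.Fin.Subset.Properties
  using ( p─⊥≡p; ∣⊥∣≡0; Empty-unique; nonempty?; x∉⁅y⁆⇒x≢y; p─q⊆p; ∣p∣≤∣x∷p∣
        ; x∈p∧x≢y⇒x∈p-y; x∈p⇒∣p-x∣<∣p∣; x∈p∪q⁺; x∈p∪q⁻; x∈⁅x⁆; x∈⁅y⁆⇒x≡y; ∣⁅x⁆∣≡1; ∣p∣≤n; ∈⊤)
open import Data.Bool.Properties using () renaming (_≟_ to _≟ᵇ_)
open import Data.Vec using ([]; _∷_; here; there)
open import Data.Vec.Properties using (≡-dec)
open import Data.List using (List; []; _∷_; length)
open import Data.List.Relation.Unary.All using (All; []; _∷_)
import Data.List.Relation.Unary.All as All
open import Data.List.Relation.Unary.AllPairs using ([]; _∷_)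
open import Data.List.Relation.Unary.Unique.Propositional using (Unique)
open import Data.Product using (∃; Σ; _,_; proj₁; proj₂)
open import Data.Sum using (_⊎_; inj₁; inj₂)
import Data.Sum as Sum
open import Data.Empty using (⊥; ⊥-elim)
open import Effect.Monad using (RawMonad)
open import Function using (_∘_; _$_; case_of_)
open import Function.Definitions using (Injective)
open import Level using (0ℓ)
open import Relation.Binary using (tri<; tri≈; tri>)
open import Relation.Nullary using (¬_; Dec; yes; no; ¬?)
open import Relation.Nullary.Decidable using (_×-dec_; decidable-stable)
open import Relation.Nullary.Negation using (contradiction; contraposition; ¬¬-Monad; ¬¬-map)
open import Relation.Binary.PropositionalEquality hiding ([_])

open RawMonad (¬¬-Monad {a = 0ℓ}) using (pure; _>>=_)

private
  variable
    A B P : Set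
    k m n d L : ℕ
    x y z : Fin n
    p : Subset n

x∈p─q⇒x∉q : ∀ (p q : Subset n) → x ∈ p ─ q → x ∉ q
x∈p─q⇒x∉q (_ ∷ p) (inside ∷ q) () here
x∈p─q⇒x∉q (_ ∷ p) (_ ∷ q) (there x∈p─q) (there x∈q) = x∈p─q⇒x∉q p q x∈p─q x∈q

x∈p-y⁻ : ∀ (p : Subset n) → x ∈ p - y → x ∈ p × x ≢ y
x∈p-y⁻ {y = y} p x∈p-y = p─q⊆p p ⁅ y ⁆ x∈p-y , x∉⁅y⁆⇒x≢y (x∈p─q⇒x∉q p ⁅ y ⁆ x∈p-y)

∣p∣≡1+∣p-x∣ : x ∈ p → ∣ p ∣ ≡ suc ∣ p - x ∣
∣p∣≡1+∣p-x∣ {p = inside ∷ p} here = cong (suc ∘ ∣_∣) (sym (p─⊥≡p p))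
∣p∣≡1+∣p-x∣ {p = inside ∷ p} (there x∈p) = cong suc (∣p∣≡1+∣p-x∣ x∈p)
∣p∣≡1+∣p-x∣ {p = outside ∷ p} (there x∈p) = ∣p∣≡1+∣p-x∣ x∈p

∣p∪q∣≤∣p∣+∣q∣ : ∀ (p q : Subset n) → ∣ p ∪ q ∣ ≤ ∣ p ∣ + ∣ q ∣
∣p∪q∣≤∣p∣+∣q∣ [] [] = z≤n
∣p∪q∣≤∣p∣+∣q∣ (inside ∷ p) (s ∷ q) =
  s≤s (≤-trans (∣p∪q∣≤∣p∣+∣q∣ p q) (+-monoʳ-≤ ∣ p ∣ (∣p∣≤∣x∷p∣ s q)))
∣p∪q∣≤∣p∣+∣q∣ (outside ∷ p) (inside ∷ q) =
  subst (∣ p ∪ q ∣ <_) (sym (+-suc ∣ p ∣ ∣ q ∣)) (s≤s (∣p∪q∣≤∣p∣+∣q∣ p q))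
∣p∪q∣≤∣p∣+∣q∣ (outside ∷ p) (outside ∷ q) = ∣p∪q∣≤∣p∣+∣q∣ p q

unique⇒length≤∣p∣ : ∀ {xs : List (Fin n)} → Unique xs → All (_∈ p) xs → length xs ≤ ∣ p ∣
unique⇒length≤∣p∣ [] [] = z≤n
unique⇒length≤∣p∣ (x≢xs ∷ unique) (x∈p ∷ xs⊆p) =
  <-≤-trans (s≤s (unique⇒length≤∣p∣ unique xs⊆p-x)) (x∈p⇒∣p-x∣<∣p∣ x∈p)
  where
  xs⊆p-x = All.zipWith (λ (y∈p , x≢y) → x∈p∧x≢y⇒x∈p-y y∈p (≢-sym x≢y)) (xs⊆p , x≢xs)

∣p∣≡1+m⇒∃x∈p : ∀ {n m} {p : Subset n} → ∣ p ∣ ≡ suc m → ∃ λ x → x ∈ p × ∣ p - x ∣ ≡ m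
∣p∣≡1+m⇒∃x∈p {n} {p = p} ∣p∣≡1+m with nonempty? p
... | yes (x , x∈p) = x , x∈p , suc-injective (trans (sym (∣p∣≡1+∣p-x∣ x∈p)) ∣p∣≡1+m)
... | no empty = contradiction ∣⊥∣≡1+m (subst (_≢ suc _) (sym (∣⊥∣≡0 n)) 0≢1+n)
  where ∣⊥∣≡1+m = trans (cong ∣_∣ (sym (Empty-unique empty))) ∣p∣≡1+m

∣p∣≡3⇒three-members : ∣ p ∣ ≡ 3 →
  ∃ λ x → ∃ λ y → ∃ λ z → x ∈ p × y ∈ p × z ∈ p × x ≢ y × x ≢ z × y ≢ z
∣p∣≡3⇒three-members {p = p} ∣p∣≡3 with ∣p∣≡1+m⇒∃x∈p ∣p∣≡3
... | x , x∈p , ∣p-x∣≡2 with ∣p∣≡1+m⇒∃x∈p ∣p-x∣≡2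
... | y , y∈p-x , ∣p-x-y∣≡1 with ∣p∣≡1+m⇒∃x∈p ∣p-x-y∣≡1
... | z , z∈p-x-y , _ with x∈p-y⁻ p y∈p-x | x∈p-y⁻ (p - x) z∈p-x-y
... | y∈p , y≢x | z∈p-x , z≢y with x∈p-y⁻ p z∈p-x
... | z∈p , z≢x = x , y , z , x∈p , y∈p , z∈p , ≢-sym y≢x , ≢-sym z≢x , ≢-sym z≢y

_≟ˢ_ : (p q : Subset n) → Dec (p ≡ q)
_≟ˢ_ = ≡-dec _≟ᵇ_

triple : Fin n → Fin n → Fin n → Subset n
triple x y z = ⁅ x ⁆ ∪ ⁅ y ⁆ ∪ ⁅ z ⁆

x∈triple : x ∈ triple x y z
x∈triple {x = x} = x∈p∪q⁺ (inj₁ (x∈⁅x⁆ x))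

y∈triple : y ∈ triple x y z
y∈triple {y = y} {x = x} = x∈p∪q⁺ {p = ⁅ x ⁆} (inj₂ (x∈p∪q⁺ (inj₁ (x∈⁅x⁆ y))))

z∈triple : z ∈ triple x y z
z∈triple {z = z} {x = x} {y = y} = x∈p∪q⁺ {p = ⁅ x ⁆} (inj₂ (x∈p∪q⁺ {p = ⁅ y ⁆} (inj₂ (x∈⁅x⁆ z))))

∈triple⁻ : ∀ {w} → w ∈ triple x y z → w ≡ x ⊎ w ≡ y ⊎ w ≡ z
∈triple⁻ {x = x} {y = y} {z = z} w∈xyz with x∈p∪q⁻ ⁅ x ⁆ _ w∈xyz
... | inj₁ w∈x = inj₁ (x∈⁅y⁆⇒x≡y x w∈x)
... | inj₂ w∈yz = inj₂ $ Sum.map (x∈⁅y⁆⇒x≡y y) (x∈⁅y⁆⇒x≡y z) (x∈p∪q⁻ ⁅ y ⁆ ⁅ z ⁆ w∈yz)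

∣triple∣≡3 : x ≢ y → x ≢ z → y ≢ z → ∣ triple x y z ∣ ≡ 3
∣triple∣≡3 {x = x} {y = y} {z = z} x≢y x≢z y≢z = ≤-antisym ∣xyz∣≤3
  (unique⇒length≤∣p∣ ((x≢y ∷ x≢z ∷ []) ∷ (y≢z ∷ []) ∷ [] ∷ [])
                     (x∈triple ∷ y∈triple ∷ z∈triple ∷ []))
  where
  open ≤-Reasoning
  ∣xyz∣≤3 : ∣ triple x y z ∣ ≤ 3
  ∣xyz∣≤3 = begin
    ∣ ⁅ x ⁆ ∪ ⁅ y ⁆ ∪ ⁅ z ⁆ ∣            ≤⟨ ∣p∪q∣≤∣p∣+∣q∣ ⁅ x ⁆ _ ⟩
    ∣ ⁅ x ⁆ ∣ + ∣ ⁅ y ⁆ ∪ ⁅ z ⁆ ∣        ≤⟨ +-monoʳ-≤ ∣ ⁅ x ⁆ ∣ (∣p∪q∣≤∣p∣+∣q∣ ⁅ y ⁆ ⁅ z ⁆) ⟩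
    ∣ ⁅ x ⁆ ∣ + (∣ ⁅ y ⁆ ∣ + ∣ ⁅ z ⁆ ∣)  ≡⟨ cong₂ _+_ (∣⁅x⁆∣≡1 x)
                                             (cong₂ _+_ (∣⁅x⁆∣≡1 y) (∣⁅x⁆∣≡1 z)) ⟩
    3                                   ∎

missing-value : m < n → (f : Fin m → Fin n) → ∃ λ c → ∀ i → f i ≢ c
missing-value m<n f with any? (λ c → all? (λ i → ¬? (f i ≟ c)))
... | yes missed = missed
... | no ¬missed = contradiction (injective⇒≤ preimage-injective) (<⇒≱ m<n)
  where
  preimage : ∀ c → ∃ λ i → f i ≡ c
  preimage c with any? (λ i → f i ≟ c)
  ... | yes hit = hit
  ... | no ¬hit = contradiction (c , λ i fi≡c → ¬hit (i , fi≡c)) ¬missed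
  preimage-injective : Injective _≡_ _≡_ (proj₁ ∘ preimage)
  preimage-injective {c} {c′} eq =
    trans (sym (proj₂ (preimage c))) (trans (cong f eq) (proj₂ (preimage c′)))

AtMostTwoToOne : (A → B) → Set
AtMostTwoToOne f = ∀ {x y z} → x ≢ y → x ≢ z → y ≢ z → f x ≡ f y → f x ≡ f z → ⊥

two-of-three : ∀ (a b c : Fin 2) → a ≡ b ⊎ a ≡ c ⊎ b ≡ c
two-of-three zero zero _ = inj₁ refl
two-of-three (suc zero) (suc zero) _ = inj₁ refl
two-of-three zero (suc zero) zero = inj₂ (inj₁ refl)
two-of-three zero (suc zero) (suc zero) = inj₂ (inj₂ refl)
two-of-three (suc zero) zero zero = inj₂ (inj₂ refl)
two-of-three (suc zero) zero (suc zero) = inj₂ (inj₁ refl)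

separated-by-bit⇒atMostTwoToOne : ∀ (f : A → B) (g : A → Fin 2) →
  (∀ {x y} → f x ≡ f y → g x ≡ g y → x ≡ y) → AtMostTwoToOne f
separated-by-bit⇒atMostTwoToOne f g separated {x} {y} {z} x≢y x≢z y≢z fx≡fy fx≡fz
  with two-of-three (g x) (g y) (g z)
... | inj₁ gx≡gy = x≢y (separated fx≡fy gx≡gy)
... | inj₂ (inj₁ gx≡gz) = x≢z (separated fx≡fz gx≡gz)
... | inj₂ (inj₂ gy≡gz) = y≢z (separated (trans (sym fx≡fy) fx≡fz) gy≡gz)

indicator : Dec P → Fin 2
indicator (yes _) = suc zero
indicator (no _) = zero

indicator-yes : P → (p? : Dec P) → indicator p? ≡ suc zero
indicator-yes p (yes _) = refl
indicator-yes p (no ¬p) = contradiction p ¬p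

indicator-suc⇒yes : (p? : Dec P) → indicator p? ≡ suc zero → P
indicator-suc⇒yes (yes p) _ = p

-- Tagging each point with whether an earlier point has the same image gives an injection into
-- Fin m × Fin 2.
atMostTwoToOne⇒≤m+m : ∀ (f : Fin n → Fin m) → AtMostTwoToOne f → n ≤ m + m
atMostTwoToOne⇒≤m+m {n} {m} f atMostTwo =
  subst (n ≤_) m*2≡m+m (injective⇒≤ code-injective)
  where
  m*2≡m+m : m * 2 ≡ m + m
  m*2≡m+m = trans (*-comm m 2) (cong (m +_) (+-identityʳ m))
  earlier-mate? : ∀ x → Dec (∃ λ y → y <ᶠ x × f y ≡ f x)
  earlier-mate? x = any? λ y → (y <ᶠ? x) ×-dec (f y ≟ f x)
  code : Fin n → Fin (m * 2)
  code x = combine (f x) (indicator (earlier-mate? x))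
  later-distinguished : ∀ {i j} → i <ᶠ j → f i ≡ f j →
    indicator (earlier-mate? i) ≢ indicator (earlier-mate? j)
  later-distinguished {i} {j} i<j fi≡fj same
    with indicator-suc⇒yes (earlier-mate? i)
           (trans same (indicator-yes (i , i<j , fi≡fj) (earlier-mate? j)))
  ... | y , y<i , fy≡fi =
    atMostTwo (<⇒≢ y<i) (<⇒≢ (<-trans y<i i<j)) (<⇒≢ i<j) fy≡fi (trans fy≡fi fi≡fj)
  code-injective : Injective _≡_ _≡_ code
  code-injective {i} {j} eq with combine-injective (f i) _ (f j) _ eq | <-cmp i j
  ... | _ | tri≈ _ i≡j _ = i≡j
  ... | fi≡fj , same | tri< i<j _ _ = contradiction same (later-distinguished i<j fi≡fj)
  ... | fi≡fj , same | tri> _ _ j<i = contradiction (sym same) (later-distinguished j<i (sym fi≡fj))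

half : Fin k → Fin ⌈ k /2⌉
half zero = zero
half (suc zero) = zero
half (suc (suc i)) = suc (half i)

parity : Fin k → Fin 2
parity zero = zero
parity (suc zero) = suc zero
parity (suc (suc i)) = parity i

half-parity-separated : ∀ {i j : Fin k} → half i ≡ half j → parity i ≡ parity j → i ≡ j
half-parity-separated {i = zero} {zero} _ _ = refl
half-parity-separated {i = zero} {suc zero} _ ()
half-parity-separated {i = zero} {suc (suc j)} () _
half-parity-separated {i = suc zero} {zero} _ ()
half-parity-separated {i = suc zero} {suc zero} _ _ = refl
half-parity-separated {i = suc zero} {suc (suc j)} () _
half-parity-separated {i = suc (suc i)} {zero} () _
half-parity-separated {i = suc (suc i)} {suc zero} () _
half-parity-separated {i = suc (suc i)} {suc (suc j)} h≡ p≡ =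
  cong (λ i → suc (suc i)) (half-parity-separated (fsuc-injective h≡) p≡)

half-atMostTwoToOne : AtMostTwoToOne (half {k})
half-atMostTwoToOne = separated-by-bit⇒atMostTwoToOne half parity half-parity-separated

inject₁≢suc : ∀ (i : Fin n) → inject₁ i ≢ suc i
inject₁≢suc zero ()
inject₁≢suc (suc i) = inject₁≢suc i ∘ fsuc-injective

opposite-inject₁ : ∀ (i : Fin n) → opposite (inject₁ i) ≡ suc (opposite i)
opposite-inject₁ {suc zero} zero = refl
opposite-inject₁ {suc (suc n)} zero = refl
opposite-inject₁ {suc (suc n)} (suc i) = cong inject₁ (opposite-inject₁ i)

opposite-injective : Injective _≡_ _≡_ (opposite {n})
opposite-injective {x = i} {j} eq =
  trans (sym (opposite-involutive i)) (trans (cong opposite eq) (opposite-involutive j))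

inject₁-or-last : ∀ (j : Fin (suc n)) → (∃ λ i → j ≡ inject₁ i) ⊎ j ≡ fromℕ n
inject₁-or-last {zero} zero = inj₂ refl
inject₁-or-last {suc n} zero = inj₁ (zero , refl)
inject₁-or-last {suc n} (suc j) with inject₁-or-last j
... | inj₁ (i , j≡i) = inj₁ (suc i , cong suc j≡i)
... | inj₂ j≡last = inj₂ (cong suc j≡last)

module _ {n} (H : Hypergraph3 n) where

  Adjacent : Fin n → Fin n → Set
  Adjacent u x = ∃ λ t → Edge H t × u ∈ t × x ∈ t

  -- Adjacency is undecidable, so "v has at most d shadow-neighbours in S" is witnessed by a list
  -- of at most d vertices containing all of them.
  DegreeAtMost : Subset n → Fin n → ℕ → Set
  DegreeAtMost S v d = ∃ λ m → m ≤ d × Σ (Fin m → Fin n) λ g →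
    ∀ x → x ∈ S → x ≢ v → Adjacent v x → ∃ λ j → x ≡ g j

  Degenerate : ℕ → Set
  Degenerate d = ∀ S u → u ∈ S → ¬ ¬ (∃ λ v → v ∈ S × DegreeAtMost S v d)

  four-in-edge : ∀ {t a b c d} → Edge H t → a ∈ t → b ∈ t → c ∈ t → d ∈ t →
    a ≢ b → a ≢ c → a ≢ d → b ≢ c → b ≢ d → c ≢ d → ⊥
  four-in-edge {t} t∈H a∈t b∈t c∈t d∈t a≢b a≢c a≢d b≢c b≢d c≢d = 4≰3
    (subst (4 ≤_) (uniform H t t∈H) (unique⇒length≤∣p∣
      ((a≢b ∷ a≢c ∷ a≢d ∷ []) ∷ (b≢c ∷ b≢d ∷ []) ∷ (c≢d ∷ []) ∷ [] ∷ [])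
      (a∈t ∷ b∈t ∷ c∈t ∷ d∈t ∷ [])))
    where
    4≰3 : ¬ 4 ≤ 3
    4≰3 (s≤s (s≤s (s≤s ())))

module BergePaths {n} (H : Hypergraph3 n) (S : Subset n) where

  record BergePath (L : ℕ) : Set where
    field
      vertex : Fin (suc L) → Fin n
      edge : Fin L → Subset n
      vertex-injective : Injective _≡_ _≡_ vertex
      edge-injective : Injective _≡_ _≡_ edge
      edge∈H : ∀ i → Edge H (edge i)
      vertex∈edgeˡ : ∀ i → vertex (inject₁ i) ∈ edge i
      vertex∈edgeʳ : ∀ i → vertex (suc i) ∈ edge i
      vertex∈S : ∀ i → vertex i ∈ S

    vertex-≢ : ∀ {i j} → i ≢ j → vertex i ≢ vertex j
    vertex-≢ = contraposition vertex-injective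

    edge-≢ : ∀ {i j} → i ≢ j → edge i ≢ edge j
    edge-≢ = contraposition edge-injective

  open BergePath

  containsBergePath : BergePath L → ContainsBergePath H L
  containsBergePath P = vertex P , edge P , vertex-injective P , edge-injective P , edge∈H P ,
    λ i → vertex∈edgeˡ P i , vertex∈edgeʳ P i

  [_] : ∀ {u} → u ∈ S → BergePath 0
  [_] {u} u∈S = record
    { vertex = λ _ → u ; edge = λ () ; vertex-injective = λ { {zero} {zero} _ → refl }
    ; edge-injective = λ { {()} } ; edge∈H = λ () ; vertex∈edgeˡ = λ () ; vertex∈edgeʳ = λ ()
    ; vertex∈S = λ { zero → u∈S } }

  prepend : ∀ (P : BergePath L) {x t} → x ∈ S → (∀ i → x ≢ vertex P i) →
    Edge H t → (∀ i → t ≢ edge P i) → x ∈ t → vertex P zero ∈ t → BergePath (suc L)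
  prepend P {x} {t} x∈S x∉P t∈H t∉P x∈t v₀∈t = record
    { vertex = λ { zero → x ; (suc i) → vertex P i }
    ; edge = λ { zero → t ; (suc i) → edge P i }
    ; vertex-injective = λ
      { {zero} {zero} _ → refl
      ; {zero} {suc j} x≡vⱼ → contradiction x≡vⱼ (x∉P j)
      ; {suc i} {zero} vᵢ≡x → contradiction (sym vᵢ≡x) (x∉P i)
      ; {suc i} {suc j} vᵢ≡vⱼ → cong suc (vertex-injective P vᵢ≡vⱼ) }
    ; edge-injective = λ
      { {zero} {zero} _ → refl
      ; {zero} {suc j} t≡eⱼ → contradiction t≡eⱼ (t∉P j)
      ; {suc i} {zero} eᵢ≡t → contradiction (sym eᵢ≡t) (t∉P i)
      ; {suc i} {suc j} eᵢ≡eⱼ → cong suc (edge-injective P eᵢ≡eⱼ) }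
    ; edge∈H = λ { zero → t∈H ; (suc i) → edge∈H P i }
    ; vertex∈edgeˡ = λ { zero → x∈t ; (suc i) → vertex∈edgeˡ P i }
    ; vertex∈edgeʳ = λ { zero → v₀∈t ; (suc i) → vertex∈edgeʳ P i }
    ; vertex∈S = λ { zero → x∈S ; (suc i) → vertex∈S P i } }

  tail : BergePath (suc L) → BergePath L
  tail P = record
    { vertex = vertex P ∘ suc ; edge = edge P ∘ suc
    ; vertex-injective = fsuc-injective ∘ vertex-injective P
    ; edge-injective = fsuc-injective ∘ edge-injective P
    ; edge∈H = edge∈H P ∘ suc ; vertex∈edgeˡ = vertex∈edgeˡ P ∘ suc
    ; vertex∈edgeʳ = vertex∈edgeʳ P ∘ suc ; vertex∈S = vertex∈S P ∘ suc }

  reverse : BergePath L → BergePath L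
  reverse P = record
    { vertex = vertex P ∘ opposite ; edge = edge P ∘ opposite
    ; vertex-injective = opposite-injective ∘ vertex-injective P
    ; edge-injective = opposite-injective ∘ edge-injective P
    ; edge∈H = edge∈H P ∘ opposite
    ; vertex∈edgeˡ = λ i → subst (λ j → vertex P j ∈ edge P (opposite i))
        (sym (opposite-inject₁ i)) (vertex∈edgeʳ P (opposite i))
    ; vertex∈edgeʳ = vertex∈edgeˡ P ∘ opposite
    ; vertex∈S = vertex∈S P ∘ opposite }

  first-edge-full : ∀ (P : BergePath (suc L)) {a x} → (∀ i → a ≢ vertex P i) →
    a ∈ edge P zero → x ∈ edge P zero → x ≢ vertex P zero → x ≢ vertex P (suc zero) → x ≢ a → ⊥
  first-edge-full P a∉P a∈e₀ x∈e₀ x≢v₀ x≢v₁ x≢a = four-in-edge H (edge∈H P zero)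
    (vertex∈edgeˡ P zero) (vertex∈edgeʳ P zero) a∈e₀ x∈e₀
    (vertex-≢ P λ ()) (≢-sym (a∉P zero)) (≢-sym x≢v₀) (≢-sym (a∉P _)) (≢-sym x≢v₁) (≢-sym x≢a)

  later-edge-full : ∀ (P : BergePath (suc L)) i {x} → vertex P zero ∈ edge P (suc i) →
    x ∈ edge P (suc i) → x ≢ vertex P zero → x ≢ vertex P (suc (inject₁ i)) →
    x ≢ vertex P (suc (suc i)) → ⊥
  later-edge-full P i v₀∈e x∈e x≢v₀ x≢vᵢ x≢vᵢ₊₁ = four-in-edge H (edge∈H P (suc i))
    (vertex∈edgeˡ P (suc i)) (vertex∈edgeʳ P (suc i)) v₀∈e x∈e
    (vertex-≢ P (inject₁≢suc (suc i))) (vertex-≢ P λ ()) (≢-sym x≢vᵢ)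
    (vertex-≢ P λ ()) (≢-sym x≢vᵢ₊₁) (≢-sym x≢v₀)

  edge∋ends⇒last : ∀ (P : BergePath (suc (suc L))) {b} → (∀ i → b ≢ vertex P i) →
    b ∈ edge P zero → ∀ i → vertex P zero ∈ edge P i →
    vertex P (fromℕ (suc (suc L))) ∈ edge P i → i ≡ fromℕ (suc L)
  edge∋ends⇒last P b∉P b∈e₀ zero _ vₗ∈e₀ =
    ⊥-elim (first-edge-full P b∉P b∈e₀ vₗ∈e₀ (vertex-≢ P λ ()) (vertex-≢ P λ ()) (≢-sym (b∉P _)))
  edge∋ends⇒last {L} P b∉P b∈e₀ (suc i) v₀∈e vₗ∈e with i ≟ fromℕ L
  ... | yes refl = refl
  ... | no i≢last = ⊥-elim (later-edge-full P i v₀∈e vₗ∈e (vertex-≢ P λ ())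
    (vertex-≢ P (fromℕ≢inject₁ ∘ fsuc-injective))
    (vertex-≢ P (i≢last ∘ sym ∘ fsuc-injective ∘ fsuc-injective)))

  prepend-or-∈first : ∀ (P : BergePath (suc L)) {x t} → x ∈ S → (∀ i → x ≢ vertex P i) →
    Edge H t → vertex P zero ∈ t → x ∈ t → BergePath (suc (suc L)) ⊎ x ∈ edge P zero
  prepend-or-∈first P {x} {t} x∈S x∉P t∈H v₀∈t x∈t with any? (λ i → t ≟ˢ edge P i)
  ... | no t∉P = inj₁ (prepend P x∈S x∉P t∈H (λ i t≡eᵢ → t∉P (i , t≡eᵢ)) x∈t v₀∈t)
  ... | yes (zero , refl) = inj₂ x∈t
  ... | yes (suc i , refl) = ⊥-elim (later-edge-full P i v₀∈t x∈t (x∉P _) (x∉P _) (x∉P _))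

  -- the path b e₀ v₀ f vₗ … v₁, where vₗ is the last vertex of P
  rotate : ∀ (P : BergePath (suc L)) {b f} → b ∈ S → (∀ i → b ≢ vertex P i) →
    b ∈ edge P zero → Edge H f → (∀ i → f ≢ edge P i) → vertex P zero ∈ f →
    vertex P (fromℕ (suc L)) ∈ f → BergePath (suc (suc L))
  rotate P b∈S b∉P b∈e₀ f∈H f∉P v₀∈f vₗ∈f =
    prepend (prepend (reverse (tail P)) (vertex∈S P zero) (λ _ → vertex-≢ P λ ())
                     f∈H (f∉P ∘ suc ∘ opposite) v₀∈f vₗ∈f)
            b∈S (λ { zero → b∉P zero ; (suc i) → b∉P _ })
            (edge∈H P zero) (λ { zero → ≢-sym (f∉P zero) ; (suc i) → edge-≢ P λ () })
            b∈e₀ (vertex∈edgeˡ P zero)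

module Extension {n} (H : Hypergraph3 n) (S : Subset n) (d : ℕ) (2≤d : 2 ≤ d)
  (dense : ∀ v → v ∈ S → ¬ DegreeAtMost H S v d) where

  open BergePaths H S
  open BergePath

  neighbour-avoiding : ∀ {v m} → v ∈ S → m ≤ d → (g : Fin m → Fin n) →
    ¬ ¬ (∃ λ x → x ∈ S × x ≢ v × Adjacent H v x × ∀ j → x ≢ g j)
  neighbour-avoiding {v} v∈S m≤d g ¬found = dense v v∈S (_ , m≤d , g , covered)
    where
    covered : ∀ x → x ∈ S → x ≢ v → Adjacent H v x → ∃ λ j → x ≡ g j
    covered x x∈S x≢v v~x with any? (λ j → x ≟ g j)
    ... | yes hit = hit
    ... | no ¬hit = contradiction (x , x∈S , x≢v , v~x , λ j x≡gⱼ → ¬hit (j , x≡gⱼ)) ¬found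

  -- A neighbour of v₀ outside {b, v₁, …, vₗ₋₁} is either off P, or it is vₗ; an edge joining v₀
  -- and vₗ allows a rotation if it is new, and is the last edge of P otherwise.
  rotate-or-∈last : ∀ (P : BergePath (suc (suc L))) {b} → suc (suc L) ≤ d → b ∈ S →
    (∀ i → b ≢ vertex P i) → b ∈ edge P zero →
    ¬ ¬ (BergePath (suc (suc (suc L))) ⊎ vertex P zero ∈ edge P (fromℕ (suc L)))
  rotate-or-∈last {L} P {b} L+2≤d b∈S b∉P b∈e₀ = do
    (y , y∈S , y≢v₀ , (f , f∈H , v₀∈f , y∈f) , y∉g) ← neighbour-avoiding (vertex∈S P zero) L+2≤d g
    pure (case y ≟ vertex P last of λ where
      (yes y≡vₗ) → through-last f∈H v₀∈f (subst (_∈ f) y≡vₗ y∈f)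
      (no y≢vₗ) → Sum.map₂
        (λ y∈e₀ → ⊥-elim (first-edge-full P b∉P b∈e₀ y∈e₀ y≢v₀ (y∉g (suc zero)) (y∉g zero)))
        (prepend-or-∈first P y∈S (off-path y≢v₀ y∉g y≢vₗ) f∈H v₀∈f y∈f))
    where
    v₀ = vertex P zero
    last = fromℕ (suc (suc L))
    g : Fin (suc (suc L)) → Fin n
    g zero = b
    g (suc j) = vertex P (suc (inject₁ j))

    off-path : ∀ {y} → y ≢ v₀ → (∀ j → y ≢ g j) → y ≢ vertex P last → ∀ i → y ≢ vertex P i
    off-path y≢v₀ _ _ zero = y≢v₀
    off-path _ y∉g y≢vₗ (suc j) with inject₁-or-last j
    ... | inj₁ (i , refl) = y∉g (suc i)
    ... | inj₂ refl = y≢vₗ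

    through-last : ∀ {f} → Edge H f → v₀ ∈ f → vertex P last ∈ f →
      BergePath (suc (suc (suc L))) ⊎ v₀ ∈ edge P (fromℕ (suc L))
    through-last {f} f∈H v₀∈f vₗ∈f with any? (λ i → f ≟ˢ edge P i)
    ... | no f∉P = inj₁ (rotate P b∈S b∉P b∈e₀ f∈H (λ i f≡eᵢ → f∉P (i , f≡eᵢ)) v₀∈f vₗ∈f)
    ... | yes (i , refl) =
      inj₂ (subst (λ j → v₀ ∈ edge P j) (edge∋ends⇒last P b∉P b∈e₀ i v₀∈f vₗ∈f) v₀∈f)

  extend-through-full-first : ∀ (P : BergePath (suc L)) {w} → suc L ≤ d → w ∈ S →
    (∀ i → w ≢ vertex P i) → w ∈ edge P zero → ¬ ¬ BergePath (suc (suc L))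
  extend-through-full-first {zero} P {w} _ w∈S w∉P w∈e₀ = do
    (y , y∈S , y≢v₀ , (t , t∈H , v₀∈t , y∈t) , y∉g) ← neighbour-avoiding (vertex∈S P zero) 2≤d g
    let y∉P = λ { zero → y≢v₀ ; (suc zero) → y∉g zero }
    case prepend-or-∈first P y∈S y∉P t∈H v₀∈t y∈t of λ where
      (inj₁ Q) → pure Q
      (inj₂ y∈e₀) → ⊥-elim (first-edge-full P w∉P w∈e₀ y∈e₀ y≢v₀ (y∉g zero) (y∉g (suc zero)))
    where
    g : Fin 2 → Fin n
    g zero = vertex P (suc zero)
    g (suc zero) = w
  extend-through-full-first {suc L} P {w} L+2≤d w∈S w∉P w∈e₀ = do
    inj₂ v₀∈eₗ ← rotate-or-∈last P L+2≤d w∈S w∉P w∈e₀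
      where inj₁ Q → pure Q
    inj₂ w∈eₗ ← rotate-or-∈last P′ L+2≤d (vertex∈S P zero) v₀∉P′ (vertex∈edgeˡ P zero)
      where inj₁ Q → pure Q
    ⊥-elim (later-edge-full P (fromℕ L) v₀∈eₗ w∈eₗ (w∉P _) (w∉P _) (w∉P _))
    where
    P′ = prepend (tail P) w∈S (w∉P ∘ suc) (edge∈H P zero) (λ _ → edge-≢ P λ ()) w∈e₀
      (vertex∈edgeʳ P zero)
    v₀∉P′ : ∀ i → vertex P zero ≢ vertex P′ i
    v₀∉P′ zero = ≢-sym (w∉P zero)
    v₀∉P′ (suc i) = vertex-≢ P λ ()

  extend : L ≤ d → BergePath L → ¬ ¬ BergePath (suc L)
  extend {zero} _ P = do
    (x , x∈S , x≢v₀ , (t , t∈H , v₀∈t , x∈t) , _) ← neighbour-avoiding (vertex∈S P zero) z≤n (λ ())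
    pure (prepend P x∈S (λ { zero → x≢v₀ }) t∈H (λ ()) x∈t v₀∈t)
  extend {suc L} L+1≤d P = do
    (w , w∈S , w≢v₀ , (t , t∈H , v₀∈t , w∈t) , w∉tail) ←
      neighbour-avoiding (vertex∈S P zero) L+1≤d (vertex P ∘ suc)
    let w∉P = λ { zero → w≢v₀ ; (suc i) → w∉tail i }
    case prepend-or-∈first P w∈S w∉P t∈H v₀∈t w∈t of λ where
      (inj₁ Q) → pure Q
      (inj₂ w∈e₀) → extend-through-full-first P L+1≤d w∈S w∉P w∈e₀

  path-of-length : ∀ {u} → u ∈ S → ∀ L → L ≤ suc d → ¬ ¬ BergePath L
  path-of-length u∈S zero _ = pure [ u∈S ]
  path-of-length u∈S (suc L) (s≤s L≤d) =
    path-of-length u∈S L (m≤n⇒m≤1+n L≤d) >>= extend L≤d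

module _ {n} (H : Hypergraph3 n) where

  StrongColouringOn : Subset n → (m : ℕ) → (Fin n → Fin m) → Set
  StrongColouringOn S m c =
    ∀ e → Edge H e → ∀ x y → x ∈ e → y ∈ e → x ∈ S → y ∈ S → x ≢ y → c x ≢ c y

  colour-low-vertex : ∀ {S v d} → v ∈ S → DegreeAtMost H S v d →
    ∃ (StrongColouringOn (S - v) (suc d)) → ∃ (StrongColouringOn S (suc d))
  colour-low-vertex {S} {v} v∈S (m , m≤d , g , neighbours⊆g) (c , proper) = c′ , proper′
    where
    fresh = missing-value (s≤s m≤d) (c ∘ g)
    c′ : Fin n → Fin _
    c′ x with x ≟ v
    ... | yes _ = proj₁ fresh
    ... | no _ = c x
    neighbour-colour≢ : ∀ e → Edge H e → ∀ y → v ∈ e → y ∈ e → y ∈ S → v ≢ y →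
      c y ≢ proj₁ fresh
    neighbour-colour≢ e e∈H y v∈e y∈e y∈S v≢y
      with neighbours⊆g y y∈S (≢-sym v≢y) (e , e∈H , v∈e , y∈e)
    ... | j , refl = proj₂ fresh j
    proper′ : StrongColouringOn S _ c′
    proper′ e e∈H x y x∈e y∈e x∈S y∈S x≢y with x ≟ v | y ≟ v
    ... | yes refl | yes refl = contradiction refl x≢y
    ... | yes refl | no _ = neighbour-colour≢ e e∈H y x∈e y∈e y∈S x≢y ∘ sym
    ... | no _ | yes refl = neighbour-colour≢ e e∈H x y∈e x∈e x∈S (≢-sym x≢y)
    ... | no x≢v | no y≢v =
      proper e e∈H x y x∈e y∈e (x∈p∧x≢y⇒x∈p-y x∈S x≢v) (x∈p∧x≢y⇒x∈p-y y∈S y≢v) x≢y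

  degenerate⇒colourable-on : Degenerate H d → ∀ s S → ∣ S ∣ ≤ s →
    ¬ ¬ ∃ (StrongColouringOn S (suc d))
  degenerate⇒colourable-on degenerate s S ∣S∣≤s with nonempty? S
  ... | no empty = pure ((λ _ → zero) , λ _ _ x _ _ _ x∈S _ _ → contradiction (x , x∈S) empty)
  degenerate⇒colourable-on degenerate zero S ∣S∣≤0 | yes (u , u∈S) =
    contradiction (<-≤-trans (x∈p⇒∣p-x∣<∣p∣ u∈S) ∣S∣≤0) λ ()
  degenerate⇒colourable-on degenerate (suc s) S ∣S∣≤1+s | yes (u , u∈S) = do
    (v , v∈S , low) ← degenerate S u u∈S
    colouring ← degenerate⇒colourable-on degenerate s (S - v)
      (s≤s⁻¹ (<-≤-trans (x∈p⇒∣p-x∣<∣p∣ v∈S) ∣S∣≤1+s))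
    pure (colour-low-vertex v∈S low colouring)

  degenerate⇒colourable : Degenerate H d → ¬ ¬ StrongColourable H (suc d)
  degenerate⇒colourable degenerate = do
    (c , proper) ← degenerate⇒colourable-on degenerate n ⊤ (∣p∣≤n ⊤)
    pure (c , λ e e∈H x y x∈e y∈e → proper e e∈H x y x∈e y∈e ∈⊤ ∈⊤)

  bergePathFree⇒degenerate : 2 ≤ d → BergePathFree H (suc d) → Degenerate H d
  bergePathFree⇒degenerate {d} 2≤d free S u u∈S no-low-vertex =
    path-of-length u∈S (suc d) ≤-refl (free ∘ containsBergePath)
    where
    open Extension H S d 2≤d (λ v v∈S low → no-low-vertex (v , v∈S , low))
    open BergePaths H S

  bergePathFree⇒strongColourable : 2 ≤ d → BergePathFree H (suc d) →
    ¬ ¬ StrongColourable H (suc d)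
  bergePathFree⇒strongColourable 2≤d = degenerate⇒colourable ∘ bergePathFree⇒degenerate 2≤d

  strong⇒weak : StrongColourable H k → WeakColourable H ⌈ k /2⌉
  strong⇒weak (c , strong) = half ∘ c , λ e e∈H (j , monochromatic) →
    let (x , y , z , x∈e , y∈e , z∈e , x≢y , x≢z , y≢z) = ∣p∣≡3⇒three-members (uniform H e e∈H)
    in half-atMostTwoToOne (strong e e∈H x y x∈e y∈e x≢y) (strong e e∈H x z x∈e z∈e x≢z)
         (strong e e∈H y z y∈e z∈e y≢z)
         (trans (monochromatic x x∈e) (sym (monochromatic y y∈e)))
         (trans (monochromatic x x∈e) (sym (monochromatic z z∈e)))

  strong-χ≤ : ∀ {χ m} → IsStrongChromaticNumber H χ → ¬ ¬ StrongColourable H m → χ ≤ m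
  strong-χ≤ {χ} {m} (_ , minimal) colourable =
    decidable-stable (χ ≤? m) (¬¬-map (minimal m) colourable)

  weak-χ≤ : ∀ {χ m} → IsWeakChromaticNumber H χ → ¬ ¬ WeakColourable H m → χ ≤ m
  weak-χ≤ {χ} {m} (_ , minimal) colourable =
    decidable-stable (χ ≤? m) (¬¬-map (minimal m) colourable)

complete3 : ∀ k → Hypergraph3 k
complete3 k = record { Edge = λ e → ∣ e ∣ ≡ 3 ; uniform = λ _ ∣e∣≡3 → ∣e∣≡3 }

complete3-bergePathFree : ∀ k → BergePathFree (complete3 k) k
complete3-bergePathFree k (v , _ , v-injective , _) = n≮n k (injective⇒≤ v-injective)

complete3-strongColourable : ∀ k → StrongColourable (complete3 k) k
complete3-strongColourable k = (λ x → x) , λ _ _ _ _ _ _ x≢y → x≢y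

complete3-strong-χ : ∀ {k} → 3 ≤ k → IsStrongChromaticNumber (complete3 k) k
complete3-strong-χ {k} 3≤k = complete3-strongColourable k , minimal
  where
  minimal : ∀ m → StrongColourable (complete3 k) m → k ≤ m
  minimal m (c , proper) = injective⇒≤ c-injective
    where
    c-injective : Injective _≡_ _≡_ c
    c-injective {x} {y} cx≡cy with x ≟ y
    ... | yes x≡y = x≡y
    ... | no x≢y with missing-value 3≤k (λ { zero → x ; (suc zero) → y })
    ... | z , z∉xy = contradiction cx≡cy
      (proper (triple x y z) (∣triple∣≡3 x≢y (z∉xy zero) (z∉xy (suc zero)))
              x y x∈triple y∈triple x≢y)

complete3-weak-χ : ∀ {k} → IsWeakChromaticNumber (complete3 k) ⌈ k /2⌉
complete3-weak-χ {k} = strong⇒weak (complete3 k) (complete3-strongColourable k) , minimal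
  where
  minimal : ∀ m → WeakColourable (complete3 k) m → ⌈ k /2⌉ ≤ m
  minimal m (c , weak) = subst (⌈ k /2⌉ ≤_) (sym (n≡⌈n+n/2⌉ m))
    (⌈n/2⌉-mono (atMostTwoToOne⇒≤m+m c c-atMostTwoToOne))
    where
    c-atMostTwoToOne : AtMostTwoToOne c
    c-atMostTwoToOne {x} {y} {z} x≢y x≢z y≢z cx≡cy cx≡cz =
      weak (triple x y z) (∣triple∣≡3 x≢y x≢z y≢z) (c x , monochromatic)
      where
      monochromatic : ∀ w → w ∈ triple x y z → c w ≡ c x
      monochromatic w w∈xyz with ∈triple⁻ w∈xyz
      ... | inj₁ refl = refl
      ... | inj₂ (inj₁ refl) = sym cx≡cy
      ... | inj₂ (inj₂ refl) = sym cx≡cz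

theorem1p6 : (k : ℕ) → 3 ≤ k →
    SupSchexPath k k × SupWchexPath k ⌈ k /2⌉
theorem1p6 (suc d) (s≤s 2≤d) =
    ( (λ _ H free _ χ-strong → strong-χ≤ H χ-strong (colourable H free))
    , suc d , complete3 (suc d) , complete3-bergePathFree (suc d) , complete3-strong-χ (s≤s 2≤d) )
  , ( (λ _ H free _ χ-weak → weak-χ≤ H χ-weak (¬¬-map (strong⇒weak H) (colourable H free)))
    , suc d , complete3 (suc d) , complete3-bergePathFree (suc d) , complete3-weak-χ )
  where
  colourable : ∀ {n} (H : Hypergraph3 n) → BergePathFree H (suc d) → ¬ ¬ StrongColourable H (suc d)
  colourable H = bergePathFree⇒strongColourable H 2≤d
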